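{- Every $\mathsf{BST}^{\otimes}$-conjunction fulfilled by an accessible ordered $\otimes$-graph is satisfiable by a hereditarily finite model.
   Context: Sets are elements of the von Neumann universe of well-founded sets. For sets $s,t$, $s\otimes t:=\{\{u,v\} : u\in s,\ v\in t\}$. A $\mathsf{BST}^{\otimes}$-conjunction is a finite conjunction of literals $x=y\cup z$, $x=y\setminus z$, $x=y\otimes z$, $x\neq y$ ($x,y,z$ set variables). A model is an assignment of well-founded sets to its variables making all literals true; it is hereditarily finite if all assigned sets are hereditarily finite. A $\otimes$-graph $\mathcal{G}=(\mathcal{P},\mathcal{N},\mathcal{T})$: a set of places $\mathcal{P}$, nodes $\mathcal{N}=\mathcal{P}\otimes\mathcal{P}$ (nonempty subsets of $\mathcal{P}$ of size at most 2), $\mathcal{P}\cap\mathcal{N}=\emptyset$, and a target map $\mathcal{T}:\mathcal{N}\to\mathcal{P}(\mathcal{P})$. Source places are places in no $\mathcal{T}(B)$. Accessible places form the least set containing the source places and containing $\mathcal{T}(B)$ whenever all places of node $B$ are in it; $\mathcal{G}$ is accessible if all places are accessible. A topological $\otimes$-order is a total order $\prec$ on $\mathcal{P}$ with $\max_\prec A\prec\max_\prec\mathcal{T}(A)$ for every node $A$ with $\mathcal{T}(A)\ne\emptyset$; an ordered $\otimes$-graph is a $\otimes$-graph endowed with such an order. An accessible $\mathcal{G}$ fulfills a conjunction $\Phi$ if there is $\mathfrak{F}:\mathrm{Vars}(\Phi)\to\mathcal{P}(\mathcal{P})$ with: (a) $\mathfrak{F}(x)=\mathfrak{F}(y)\star\mathfrak{F}(z)$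 for each conjunct $x=y\star z$, $\star\in\{\cup,\setminus\}$; (b) $\mathfrak{F}(x)\ne\mathfrak{F}(y)$ for each conjunct $x\neq y$; (c) for each conjunct $x=y\otimes z$: (c1) $\emptyset\neq\mathcal{T}(\{\upsilon,\zeta\})\subseteq\mathfrak{F}(x)$ for all $\upsilon\in\mathfrak{F}(y),\zeta\in\mathfrak{F}(z)$; (c2) $\mathfrak{F}(x)\subseteq\bigcup\{\mathcal{T}(B):B\in\mathfrak{F}(y)\otimes\mathfrak{F}(z)\}$; (c3) $\bigcup\{\mathcal{T}(B):B\in\mathcal{N}\setminus(\mathfrak{F}(y)\otimes\mathfrak{F}(z))\}\cap\mathfrak{F}(x)=\emptyset$. -}

module Defs where

open import Level using (0ℓ)
open import Data.Nat.Base using (ℕ; zero; suc; _%_; ⌊_/2⌋)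
open import Data.Fin.Base using (Fin)
open import Data.Fin.Subset using (Subset; _∈_; _⊆_; _∪_; _─_; Nonempty)
open import Data.List.Base using (List)
open import Data.List.Relation.Unary.All using (All)
open import Data.Product.Base using (_×_; ∃; ∃-syntax)
open import Data.Sum.Base using (_⊎_)
open import Relation.Nullary using (¬_)
open import Relation.Binary.Core using (Rel)
open import Relation.Binary.Structures using (IsStrictTotalOrder)
open import Relation.Binary.PropositionalEquality using (_≡_; _≢_)
open import Function.Bundles using (_⇔_)

-- Hereditarily finite sets, via the Ackermann coding:
-- the HF set coded by m ∈ ℕ has as elements the sets coded by the n
-- such that the n-th binary digit of m is 1.  This is a bijection
-- ℕ ≅ V_ω, and ≡ on codes coincides with extensional set equality.

bitSet : ℕ → ℕ → Set
bitSet zero    m = m % 2 ≡ 1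
bitSet (suc n) m = bitSet n ⌊ m /2⌋

_∈ₕ_ : ℕ → ℕ → Set
n ∈ₕ m = bitSet n m

IsPair : ℕ → ℕ → ℕ → Set
IsPair w u v = ∀ t → t ∈ₕ w ⇔ (t ≡ u ⊎ t ≡ v)

data Literal : Set where
  _≐_∪ₗ_ : ℕ → ℕ → ℕ → Literal
  _≐_∖ₗ_ : ℕ → ℕ → ℕ → Literal
  _≐_⊗ₗ_ : ℕ → ℕ → ℕ → Literal
  _≠ₗ_   : ℕ → ℕ → Literal

Conjunction : Set
Conjunction = List Literal

SatLit : (ℕ → ℕ) → Literal → Set
SatLit M (x ≐ y ∪ₗ z) = ∀ w → w ∈ₕ M x ⇔ (w ∈ₕ M y ⊎ w ∈ₕ M z)
SatLit M (x ≐ y ∖ₗ z) = ∀ w → w ∈ₕ M x ⇔ (w ∈ₕ M y × ¬ (w ∈ₕ M z))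
SatLit M (x ≐ y ⊗ₗ z) =
  ∀ w → w ∈ₕ M x ⇔ (∃[ u ] ∃[ v ] (u ∈ₕ M y × v ∈ₕ M z × IsPair w u v))
SatLit M (x ≠ₗ y) = M x ≢ M y

HFSatisfiable : Conjunction → Set
HFSatisfiable Φ = ∃[ M ] All (SatLit M) Φ

-- The node {i , j} (i = j allowed, giving
-- the singleton {i}) is represented by any ordered pair (i , j); the
-- target map is required to be symmetric so that it is a function of
-- the unordered node.

record ⊗Graph (n : ℕ) : Set where
  field
    T     : Fin n → Fin n → Subset n
    T-sym : ∀ i j → T i j ≡ T j i

module _ {n : ℕ} (G : ⊗Graph n) where
  open ⊗Graph G

  IsSource : Fin n → Set
  IsSource p = ∀ i j → ¬ (p ∈ T i j)

  data Accessible : Fin n → Set where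
    source : ∀ {p} → IsSource p → Accessible p
    fire   : ∀ {i j p} → Accessible i → Accessible j → p ∈ T i j → Accessible p

  IsAccessible : Set
  IsAccessible = ∀ p → Accessible p

  NodeIn⊗ : Subset n → Subset n → Fin n → Fin n → Set
  NodeIn⊗ s t i j = (i ∈ s × j ∈ t) ⊎ (j ∈ s × i ∈ t)

  FulLit : (ℕ → Subset n) → Literal → Set
  FulLit F (x ≐ y ∪ₗ z) = F x ≡ F y ∪ F z
  FulLit F (x ≐ y ∖ₗ z) = F x ≡ F y ─ F z
  FulLit F (x ≐ y ⊗ₗ z) =
      (∀ u v → u ∈ F y → v ∈ F z → Nonempty (T u v) × T u v ⊆ F x)
    × (∀ p → p ∈ F x → ∃[ i ] ∃[ j ] (NodeIn⊗ (F y) (F z) i j × p ∈ T i j))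
    × (∀ i j p → ¬ NodeIn⊗ (F y) (F z) i j → p ∈ T i j → ¬ (p ∈ F x))
  FulLit F (x ≠ₗ y) = F x ≢ F y

  Fulfills : Conjunction → Set
  Fulfills Φ = ∃[ F ] All (FulLit F) Φ

  module _ (_≺_ : Rel (Fin n) 0ℓ) where

    _≼_ : Fin n → Fin n → Set
    a ≼ b = a ≺ b ⊎ a ≡ b

    IsMax : (Fin n → Set) → Fin n → Set
    IsMax S m = S m × (∀ q → S q → q ≼ m)

    InNode : Fin n → Fin n → Fin n → Set
    InNode i j q = q ≡ i ⊎ q ≡ j

    IsTopological⊗Order : Set
    IsTopological⊗Order =
      IsStrictTotalOrder _≡_ _≺_ ×
      (∀ i j → Nonempty (T i j) → ∀ a m →
         IsMax (InNode i j) a → IsMax (_∈ T i j) m → a ≺ m)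

{-# OPTIONS --safe #-}
-- Each place q is realised by a finite set R q of hereditarily finite sets, the R q pairwise
-- disjoint, such that a pair {a, b} with a ∈ R i, b ∈ R j lies in R q for some target q of
-- the node {i, j}, and every element of R q with q not a source is such a pair.  Interpreting x
-- as the union of the R q over q ∈ F x then turns ∪, ∖ and ≠ on places into the same
-- operations on sets, and conditions (c1)–(c3) into x = y ⊗ z.
--
-- R is built in two layers.  Seeds make every R q nonempty: they follow, for each place, the
-- first stage at which it becomes accessible (sources get fresh atoms, a fired place gets pairs
-- of seeds of its firing node).  Every other pair from a node {i, j} goes to the ≺-largest
-- target of {i, j}; as the order is topological, i and j precede it, so R is defined by
-- ≺-recursion.  Disjointness is proved by induction on codes, the components of a pair having
-- smaller codes than the pair.
module Submission where

open import Defs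
open import Level using (0ℓ)
open import Data.Bool.Base using (Bool; true; false) renaming (T to Tᵇ)
open import Data.Empty using (⊥-elim)
open import Data.Nat.Base
open import Data.Nat.Properties
open import Data.Nat.Induction using (<-wellFounded)
open import Data.Nat.ListAction using (sum)
open import Data.Fin.Base using (Fin; toℕ)
open import Data.Fin.Properties using (any?; all?; toℕ<n; toℕ-injective) renaming (_≟_ to _≟ᶠ_)
open import Data.Fin.Induction using (spo-wellFounded)
open import Data.Fin.Subset using (Subset; _∈_; _∉_; _⊆_; _∪_; _─_; Nonempty)
open import Data.Fin.Subset.Properties using (_∈?_; x∈p∪q⁻; x∈p∪q⁺; p─q⊆p; x∈p∧x∉q⇒x∈p─q; ⊆-antisym)
open import Data.List.Base
  using (List; []; _∷_; _++_; allFin; filter; concatMap; applyUpTo; cartesianProductWith)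
open import Data.List.Properties using (concatMap-cong)
open import Data.List.Membership.Propositional using (find; lose) renaming (_∈_ to _∈ₗ_)
open import Data.List.Membership.Propositional.Properties
  using (∈-allFin; ∈-filter⁺; ∈-filter⁻; ∈-concatMap⁺; ∈-concatMap⁻; ∈-++⁺ˡ; ∈-++⁺ʳ; ∈-++⁻;
         ∈-applyUpTo⁺; ∈-applyUpTo⁻; ∈-cartesianProductWith⁺; ∈-cartesianProductWith⁻)
open import Data.List.Membership.DecPropositional _≟_ using () renaming (_∈?_ to _∈ₗ?_)
open import Data.List.Relation.Unary.Any using (here; there)
open import Data.List.Relation.Unary.All as All using (All)
open import Data.List.Relation.Unary.All.Properties using (all-filter)
import Data.List.Extrema
open import Data.Maybe.Base using (Maybe; just; nothing; _<∣>_)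
open import Data.Maybe.Properties using (just-injective)
open import Data.Product.Base using (_×_; _,_; proj₁; proj₂; ∃; ∃₂; ∃-syntax)
open import Data.Sum.Base using (_⊎_; inj₁; inj₂; swap)
open import Data.Vec.Base using (_∷_; here; there)
open import Function.Base using (_∘_; id)
open import Function.Bundles using (_⇔_; mk⇔; Equivalence)
open import Induction.WellFounded using (WellFounded; Acc; acc; WfRec; module All; module FixPoint)
open import Relation.Nullary using (¬_; Dec; yes; no)
open import Relation.Nullary.Decidable.Core
  using (isYes; toWitness; fromWitness; ¬?; _×-dec_; _⊎-dec_; _→-dec_)
open import Relation.Unary using (Pred; Decidable)
open import Relation.Binary.Core using (Rel)
open import Relation.Binary.Bundles using (TotalOrder)
open import Relation.Binary.Structures using (IsStrictTotalOrder; IsTotalOrder)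
open import Relation.Binary.PropositionalEquality
import Relation.Binary.Construct.StrictToNonStrict as StrictToNonStrict

open Equivalence using (to; from)

-- consBit b e = 2e + b: every element of e moves up by one, and 0 is added when b holds
consBit : Bool → ℕ → ℕ
consBit b     (suc e) = suc (suc (consBit b e))
consBit false zero    = 0
consBit true  zero    = 1

⌊consBit/2⌋ : ∀ b e → ⌊ consBit b e /2⌋ ≡ e
⌊consBit/2⌋ b     (suc e) = cong suc (⌊consBit/2⌋ b e)
⌊consBit/2⌋ false zero    = refl
⌊consBit/2⌋ true  zero    = refl

consBit-view : ∀ m → ∃₂ λ b e → consBit b e ≡ m
consBit-view 0 = false , 0 , refl
consBit-view 1 = true , 0 , refl
consBit-view (suc (suc m)) with consBit-view m
... | b , e , refl = b , suc e , refl

0∈ₕconsBit : ∀ b e → 0 ∈ₕ consBit b e ⇔ Tᵇ b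
0∈ₕconsBit b e = mk⇔ (⇒ b e) (⇐ b e)
  where
  ⇒ : ∀ b e → 0 ∈ₕ consBit b e → Tᵇ b
  ⇒ b     (suc e) = ⇒ b e
  ⇒ true  zero    _ = _
  ⇐ : ∀ b e → Tᵇ b → 0 ∈ₕ consBit b e
  ⇐ b    (suc e) = ⇐ b e
  ⇐ true zero    _ = refl

suc∈ₕconsBit : ∀ t b e → suc t ∈ₕ consBit b e ⇔ t ∈ₕ e
suc∈ₕconsBit t b e =
  mk⇔ (subst (t ∈ₕ_) (⌊consBit/2⌋ b e)) (subst (t ∈ₕ_) (sym (⌊consBit/2⌋ b e)))

∈ₕ⇒< : ∀ {t m} → t ∈ₕ m → t < m
∈ₕ⇒< {zero}  {suc m} _  = s≤s z≤n
∈ₕ⇒< {suc t} {zero}  t∈ = ⊥-elim (n≮0 (∈ₕ⇒< {t} {0} t∈))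
∈ₕ⇒< {suc t} {suc m} t∈ = ≤-<-trans (∈ₕ⇒< {t} t∈) (⌊n/2⌋<n m)

∈ₕ-ext : ∀ {m m'} → (∀ t → t ∈ₕ m ⇔ t ∈ₕ m') → m ≡ m'
∈ₕ-ext {m} {m'} = go (m + m') (m≤m+n m m') (m≤n+m m' m)
  where
  halve : ∀ {b e f} → consBit b e ≤ suc f → e ≤ f
  halve {b} {e} {f} le =
    ≤-pred (subst (_< suc f) (⌊consBit/2⌋ b e) (≤-<-trans (⌊n/2⌋-mono le) (⌊n/2⌋<n f)))
  same-bit : ∀ b b' e e' → (∀ t → t ∈ₕ consBit b e ⇔ t ∈ₕ consBit b' e') → b ≡ b'
  same-bit false false e e' _ = refl
  same-bit true  true  e e' _ = refl
  same-bit false true  e e' s =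
    ⊥-elim (to (0∈ₕconsBit false e) (from (s 0) (from (0∈ₕconsBit true e') _)))
  same-bit true  false e e' s =
    ⊥-elim (to (0∈ₕconsBit false e') (to (s 0) (from (0∈ₕconsBit true e) _)))
  go : ∀ f {m m'} → m ≤ f → m' ≤ f → (∀ t → t ∈ₕ m ⇔ t ∈ₕ m') → m ≡ m'
  go zero z≤n z≤n _ = refl
  go (suc f) {m} {m'} m≤ m'≤ s with consBit-view m | consBit-view m'
  ... | b , e , refl | b' , e' , refl =
    cong₂ consBit (same-bit b b' e e' s) (go f (halve m≤) (halve m'≤) λ t →
      mk⇔ (to (suc∈ₕconsBit t b' e') ∘ to (s (suc t)) ∘ from (suc∈ₕconsBit t b e))
          (to (suc∈ₕconsBit t b e) ∘ from (s (suc t)) ∘ from (suc∈ₕconsBit t b' e')))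

code : {P : Pred ℕ 0ℓ} → Decidable P → ℕ → ℕ
code P? zero    = 0
code P? (suc B) = consBit (isYes (P? 0)) (code (P? ∘ suc) B)

∈ₕ-code : ∀ {P : Pred ℕ 0ℓ} (P? : Decidable P) B {t} → t ∈ₕ code P? B ⇔ (t < B × P t)
∈ₕ-code P? zero    {t}     = mk⇔ (λ t∈ → ⊥-elim (n≮0 (∈ₕ⇒< {t} t∈))) (λ ())
∈ₕ-code P? (suc B) {zero}  =
  mk⇔ (λ 0∈ → s≤s z≤n , toWitness {a? = P? 0} (to (0∈ₕconsBit _ (code (P? ∘ suc) B)) 0∈))
      (λ (_ , p) → from (0∈ₕconsBit _ (code (P? ∘ suc) B)) (fromWitness {a? = P? 0} p))
∈ₕ-code P? (suc B) {suc t} =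
  mk⇔ (λ t∈ → let (t<B , p) = to (∈ₕ-code (P? ∘ suc) B) (to (suc∈ₕconsBit t _ _) t∈) in s≤s t<B , p)
      (λ (t<B , p) → from (suc∈ₕconsBit t _ _) (from (∈ₕ-code (P? ∘ suc) B) (s≤s⁻¹ t<B , p)))

∈⇒≤sum : ∀ {t L} → t ∈ₗ L → t ≤ sum L
∈⇒≤sum {L = x ∷ L} (here refl) = m≤m+n x (sum L)
∈⇒≤sum {L = x ∷ L} (there t∈) = ≤-trans (∈⇒≤sum t∈) (m≤n+m (sum L) x)

⟦_⟧ : List ℕ → ℕ
⟦ L ⟧ = code (_∈ₗ? L) (suc (sum L))

∈ₕ⟦⟧ : ∀ L {t} → t ∈ₕ ⟦ L ⟧ ⇔ t ∈ₗ L
∈ₕ⟦⟧ L = mk⇔ (proj₂ ∘ to (∈ₕ-code (_∈ₗ? L) (suc (sum L))))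
             λ t∈ → from (∈ₕ-code (_∈ₗ? L) (suc (sum L))) (s≤s (∈⇒≤sum t∈) , t∈)

pair : ℕ → ℕ → ℕ
pair a b = ⟦ a ∷ b ∷ [] ⟧

IsPair-pair : ∀ a b → IsPair (pair a b) a b
IsPair-pair a b t = mk⇔ (∈-two ∘ to (∈ₕ⟦⟧ (a ∷ b ∷ []))) (from (∈ₕ⟦⟧ (a ∷ b ∷ [])) ∘ two-∈)
  where
  ∈-two : t ∈ₗ a ∷ b ∷ [] → t ≡ a ⊎ t ≡ b
  ∈-two (here t≡a)         = inj₁ t≡a
  ∈-two (there (here t≡b)) = inj₂ t≡b
  two-∈ : t ≡ a ⊎ t ≡ b → t ∈ₗ a ∷ b ∷ []
  two-∈ (inj₁ t≡a) = here t≡a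
  two-∈ (inj₂ t≡b) = there (here t≡b)

IsPair⇒≡pair : ∀ {w a b} → IsPair w a b → w ≡ pair a b
IsPair⇒≡pair {w} {a} {b} w≗ab =
  ∈ₕ-ext λ t → mk⇔ (from (IsPair-pair a b t) ∘ to (w≗ab t)) (from (w≗ab t) ∘ to (IsPair-pair a b t))

IsPair-sym : ∀ {w a b} → IsPair w a b → IsPair w b a
IsPair-sym w≗ab t = mk⇔ (swap ∘ to (w≗ab t)) (from (w≗ab t) ∘ swap)

pairˡ< : ∀ a b → a < pair a b
pairˡ< a b = ∈ₕ⇒< (from (IsPair-pair a b a) (inj₁ refl))

pairʳ< : ∀ a b → b < pair a b
pairʳ< a b = ∈ₕ⇒< (from (IsPair-pair a b b) (inj₂ refl))

pair≡⇒⊆ : ∀ {a b a' b'} → pair a b ≡ pair a' b' → ∀ t → t ≡ a ⊎ t ≡ b → t ≡ a' ⊎ t ≡ b'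
pair≡⇒⊆ {a} {b} {a'} {b'} eq t =
  to (IsPair-pair a' b' t) ∘ subst (t ∈ₕ_) eq ∘ from (IsPair-pair a b t)

pair-injective : ∀ {a b a' b'} → pair a b ≡ pair a' b' → (a ≡ a' × b ≡ b') ⊎ (a ≡ b' × b ≡ a')
pair-injective {a} {b} {a'} {b'} eq with pair≡⇒⊆ eq a (inj₁ refl) | pair≡⇒⊆ eq b (inj₂ refl)
... | inj₁ refl | inj₂ refl = inj₁ (refl , refl)
... | inj₂ refl | inj₁ refl = inj₂ (refl , refl)
... | inj₁ refl | inj₁ refl with pair≡⇒⊆ (sym eq) b' (inj₂ refl)
...   | inj₁ refl = inj₁ (refl , refl)
...   | inj₂ refl = inj₁ (refl , refl)
pair-injective {a} {b} {a'} {b'} eq | inj₂ refl | inj₂ refl with pair≡⇒⊆ (sym eq) a' (inj₁ refl)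
...   | inj₁ refl = inj₂ (refl , refl)
...   | inj₂ refl = inj₂ (refl , refl)

-- three elements, so never a pair
atom : ℕ → ℕ
atom m = ⟦ 0 ∷ 1 ∷ 2 + m ∷ [] ⟧

atom≢pair : ∀ m a b → atom m ≢ pair a b
atom≢pair m a b eq
  with ∈pair 0 (here refl) | ∈pair 1 (there (here refl)) | ∈pair (2 + m) (there (there (here refl)))
  where
  ∈pair : ∀ t → t ∈ₗ 0 ∷ 1 ∷ 2 + m ∷ [] → t ≡ a ⊎ t ≡ b
  ∈pair t = to (IsPair-pair a b t) ∘ subst (t ∈ₕ_) eq ∘ from (∈ₕ⟦⟧ (0 ∷ 1 ∷ 2 + m ∷ []))
... | inj₁ refl | inj₁ ()   | _
... | inj₂ refl | inj₂ ()   | _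
... | inj₁ refl | inj₂ refl | inj₁ ()
... | inj₁ refl | inj₂ refl | inj₂ ()
... | inj₂ refl | inj₁ refl | inj₁ ()
... | inj₂ refl | inj₁ refl | inj₂ ()

atom-injective : ∀ {m m'} → atom m ≡ atom m' → m ≡ m'
atom-injective {m} {m'} eq
  with to (∈ₕ⟦⟧ (0 ∷ 1 ∷ 2 + m' ∷ []) {2 + m})
          (subst ((2 + m) ∈ₕ_) eq (from (∈ₕ⟦⟧ (0 ∷ 1 ∷ 2 + m ∷ [])) (there (there (here refl)))))
... | there (there (here refl)) = refl

x∈p─q⇒x∉q : ∀ {m} (p q : Subset m) {x} → x ∈ p ─ q → x ∉ q
x∈p─q⇒x∉q (true ∷ p) (false ∷ q) here      ()
x∈p─q⇒x∉q (_ ∷ p)    (_ ∷ q)     (there x∈) (there x∈q) = x∈p─q⇒x∉q p q x∈ x∈q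

module _ {n : ℕ} (G : ⊗Graph n) where
  open ⊗Graph G

  ⊗Fulfilled : Subset n → Subset n → Subset n → Set
  ⊗Fulfilled S S₁ S₂ =
      (∀ u v → u ∈ S₁ → v ∈ S₂ → Nonempty (T u v) × T u v ⊆ S)
    × (∀ p → p ∈ S → ∃[ i ] ∃[ j ] (NodeIn⊗ G S₁ S₂ i j × p ∈ T i j))
    × (∀ i j p → ¬ NodeIn⊗ G S₁ S₂ i j → p ∈ T i j → ¬ (p ∈ S))

  record Realization : Set where
    field
      R           : Fin n → List ℕ
      R-disjoint  : ∀ {e q q'} → e ∈ₗ R q → e ∈ₗ R q' → q ≡ q'
      R-inhabited : ∀ q → ∃ (_∈ₗ R q)
      R-closed    : ∀ {i j a b} → Nonempty (T i j) → a ∈ₗ R i → b ∈ₗ R j →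
                    ∃ λ q → q ∈ T i j × pair a b ∈ₗ R q
      R-pairs     : ∀ {e q} → e ∈ₗ R q → (∃₂ λ i j → q ∈ T i j) →
                    ∃₂ λ i j → ∃₂ λ a b → q ∈ T i j × a ∈ₗ R i × b ∈ₗ R j × e ≡ pair a b

module Model {n : ℕ} {G : ⊗Graph n} (ρ : Realization G) where
  open ⊗Graph G
  open Realization ρ

  R⋃ : Subset n → List ℕ
  R⋃ S = concatMap R (filter (_∈? S) (allFin n))

  ⟪_⟫ : Subset n → ℕ
  ⟪ S ⟫ = ⟦ R⋃ S ⟧

  ∈ₕ⟪⟫ : ∀ S e → e ∈ₕ ⟪ S ⟫ ⇔ ∃ λ q → q ∈ S × e ∈ₗ R q
  ∈ₕ⟪⟫ S e = mk⇔ ⇒ ⇐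
    where
    ⇒ : e ∈ₕ ⟪ S ⟫ → ∃ λ q → q ∈ S × e ∈ₗ R q
    ⇒ e∈ with find (∈-concatMap⁻ R {xs = filter (_∈? S) (allFin n)} (to (∈ₕ⟦⟧ (R⋃ S)) e∈))
    ... | q , q∈ , e∈R = q , proj₂ (∈-filter⁻ (_∈? S) {xs = allFin n} q∈) , e∈R
    ⇐ : (∃ λ q → q ∈ S × e ∈ₗ R q) → e ∈ₕ ⟪ S ⟫
    ⇐ (q , q∈S , e∈R) =
      from (∈ₕ⟦⟧ (R⋃ S)) (∈-concatMap⁺ R (lose (∈-filter⁺ (_∈? S) (∈-allFin q) q∈S) e∈R))

  owner-∈ₕ⟪⟫ : ∀ S {e q} → e ∈ₗ R q → e ∈ₕ ⟪ S ⟫ ⇔ q ∈ S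
  owner-∈ₕ⟪⟫ S {e} {q} e∈R = mk⇔ ⇒ (λ q∈S → from (∈ₕ⟪⟫ S e) (q , q∈S , e∈R))
    where
    ⇒ : e ∈ₕ ⟪ S ⟫ → q ∈ S
    ⇒ e∈ with to (∈ₕ⟪⟫ S e) e∈
    ... | q' , q'∈S , e∈R' = subst (_∈ S) (R-disjoint e∈R' e∈R) q'∈S

  ⟪⟫-∪ : ∀ S₁ S₂ {e} → e ∈ₕ ⟪ S₁ ∪ S₂ ⟫ ⇔ (e ∈ₕ ⟪ S₁ ⟫ ⊎ e ∈ₕ ⟪ S₂ ⟫)
  ⟪⟫-∪ S₁ S₂ {e} = mk⇔ ⇒ ⇐
    where
    ⇒ : e ∈ₕ ⟪ S₁ ∪ S₂ ⟫ → e ∈ₕ ⟪ S₁ ⟫ ⊎ e ∈ₕ ⟪ S₂ ⟫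
    ⇒ e∈ with to (∈ₕ⟪⟫ (S₁ ∪ S₂) e) e∈
    ... | q , q∈ , e∈R with x∈p∪q⁻ S₁ S₂ q∈
    ...   | inj₁ q∈S₁ = inj₁ (from (owner-∈ₕ⟪⟫ S₁ e∈R) q∈S₁)
    ...   | inj₂ q∈S₂ = inj₂ (from (owner-∈ₕ⟪⟫ S₂ e∈R) q∈S₂)
    ⇐ : e ∈ₕ ⟪ S₁ ⟫ ⊎ e ∈ₕ ⟪ S₂ ⟫ → e ∈ₕ ⟪ S₁ ∪ S₂ ⟫
    ⇐ (inj₁ e∈) with to (∈ₕ⟪⟫ S₁ e) e∈
    ... | q , q∈ , e∈R = from (owner-∈ₕ⟪⟫ (S₁ ∪ S₂) e∈R) (x∈p∪q⁺ (inj₁ q∈))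
    ⇐ (inj₂ e∈) with to (∈ₕ⟪⟫ S₂ e) e∈
    ... | q , q∈ , e∈R = from (owner-∈ₕ⟪⟫ (S₁ ∪ S₂) e∈R) (x∈p∪q⁺ (inj₂ q∈))

  ⟪⟫-─ : ∀ S₁ S₂ {e} → e ∈ₕ ⟪ S₁ ─ S₂ ⟫ ⇔ (e ∈ₕ ⟪ S₁ ⟫ × ¬ e ∈ₕ ⟪ S₂ ⟫)
  ⟪⟫-─ S₁ S₂ {e} = mk⇔ ⇒ ⇐
    where
    ⇒ : e ∈ₕ ⟪ S₁ ─ S₂ ⟫ → e ∈ₕ ⟪ S₁ ⟫ × ¬ e ∈ₕ ⟪ S₂ ⟫
    ⇒ e∈ with to (∈ₕ⟪⟫ (S₁ ─ S₂) e) e∈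
    ... | q , q∈ , e∈R = from (owner-∈ₕ⟪⟫ S₁ e∈R) (p─q⊆p S₁ S₂ q∈)
                       , x∈p─q⇒x∉q S₁ S₂ q∈ ∘ to (owner-∈ₕ⟪⟫ S₂ e∈R)
    ⇐ : e ∈ₕ ⟪ S₁ ⟫ × ¬ e ∈ₕ ⟪ S₂ ⟫ → e ∈ₕ ⟪ S₁ ─ S₂ ⟫
    ⇐ (e∈ , e∉) with to (∈ₕ⟪⟫ S₁ e) e∈
    ... | q , q∈ , e∈R =
      from (owner-∈ₕ⟪⟫ (S₁ ─ S₂) e∈R) (x∈p∧x∉q⇒x∈p─q q∈ (e∉ ∘ from (owner-∈ₕ⟪⟫ S₂ e∈R)))

  ⟪⟫-injective : ∀ {S S'} → ⟪ S ⟫ ≡ ⟪ S' ⟫ → S ≡ S'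
  ⟪⟫-injective {S} {S'} eq = ⊆-antisym (⊆ eq) (⊆ (sym eq))
    where
    ⊆ : ∀ {S S'} → ⟪ S ⟫ ≡ ⟪ S' ⟫ → S ⊆ S'
    ⊆ {S} {S'} eq {q} q∈S with R-inhabited q
    ... | e , e∈R =
      to (owner-∈ₕ⟪⟫ S' e∈R) (subst (e ∈ₕ_) eq (from (owner-∈ₕ⟪⟫ S e∈R) q∈S))

  ⟪⟫-⊗ : ∀ S S₁ S₂ → ⊗Fulfilled G S S₁ S₂ → ∀ w →
         w ∈ₕ ⟪ S ⟫ ⇔ (∃[ u ] ∃[ v ] (u ∈ₕ ⟪ S₁ ⟫ × v ∈ₕ ⟪ S₂ ⟫ × IsPair w u v))
  ⟪⟫-⊗ S S₁ S₂ (targets⊆S , S⊆targets , S∩other-targets≡∅) w = mk⇔ ⇒ ⇐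
    where
    node? : ∀ i j → Dec (NodeIn⊗ G S₁ S₂ i j)
    node? i j = (i ∈? S₁ ×-dec j ∈? S₂) ⊎-dec (j ∈? S₁ ×-dec i ∈? S₂)
    ⇒ : w ∈ₕ ⟪ S ⟫ → ∃[ u ] ∃[ v ] (u ∈ₕ ⟪ S₁ ⟫ × v ∈ₕ ⟪ S₂ ⟫ × IsPair w u v)
    ⇒ w∈ with to (∈ₕ⟪⟫ S w) w∈
    ... | q , q∈S , w∈R with S⊆targets q q∈S
    ...   | i₀ , j₀ , _ , q∈T₀ with R-pairs w∈R (i₀ , j₀ , q∈T₀)
    ...     | i , j , a , b , q∈T , a∈R , b∈R , refl with node? i j
    ...       | yes (inj₁ (i∈ , j∈)) =
                  a , b , from (owner-∈ₕ⟪⟫ S₁ a∈R) i∈ , from (owner-∈ₕ⟪⟫ S₂ b∈R) j∈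
                , IsPair-pair a b
    ...       | yes (inj₂ (j∈ , i∈)) =
                  b , a , from (owner-∈ₕ⟪⟫ S₁ b∈R) j∈ , from (owner-∈ₕ⟪⟫ S₂ a∈R) i∈
                , IsPair-sym (IsPair-pair a b)
    ...       | no ¬node = ⊥-elim (S∩other-targets≡∅ i j q ¬node q∈T q∈S)
    ⇐ : ∃[ u ] ∃[ v ] (u ∈ₕ ⟪ S₁ ⟫ × v ∈ₕ ⟪ S₂ ⟫ × IsPair w u v) → w ∈ₕ ⟪ S ⟫
    ⇐ (u , v , u∈ , v∈ , w≗uv) with to (∈ₕ⟪⟫ S₁ u) u∈ | to (∈ₕ⟪⟫ S₂ v) v∈
    ... | i , i∈ , u∈R | j , j∈ , v∈R with targets⊆S i j i∈ j∈
    ...   | T≢∅ , T⊆S with R-closed T≢∅ u∈R v∈R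
    ...     | q , q∈T , uv∈R rewrite IsPair⇒≡pair w≗uv = from (owner-∈ₕ⟪⟫ S uv∈R) (T⊆S q∈T)

  fulfils⇒satisfies : ∀ F {L} → FulLit G F L → SatLit (⟪_⟫ ∘ F) L
  fulfils⇒satisfies F {x ≐ y ∪ₗ z} eq w rewrite eq = ⟪⟫-∪ (F y) (F z) {w}
  fulfils⇒satisfies F {x ≐ y ∖ₗ z} eq w rewrite eq = ⟪⟫-─ (F y) (F z) {w}
  fulfils⇒satisfies F {x ≐ y ⊗ₗ z} ful = ⟪⟫-⊗ (F x) (F y) (F z) ful
  fulfils⇒satisfies F {x ≠ₗ y}     neq = neq ∘ ⟪⟫-injective

module Maxima {n : ℕ} (G : ⊗Graph n) {_≺_ : Rel (Fin n) 0ℓ} (sto : IsStrictTotalOrder _≡_ _≺_) where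
  open ⊗Graph G
  private
    module ≤ = StrictToNonStrict _≡_ _≺_
    module ≺ = IsStrictTotalOrder sto

    ≼-isTotalOrder : IsTotalOrder _≡_ (_≼_ G _≺_)
    ≼-isTotalOrder = ≤.isTotalOrder sto

    ≼-totalOrder : TotalOrder 0ℓ 0ℓ 0ℓ
    ≼-totalOrder = record { isTotalOrder = ≼-isTotalOrder }

  max-exists : ∀ {P : Pred (Fin n) 0ℓ} → Decidable P → ∀ {x} → P x → ∃ (IsMax G _≺_ P)
  max-exists {P} P? {x} Px =
      Extrema.max x (filter P? (allFin n))
    , Extrema.argmax-all id {P = P} Px (all-filter P? (allFin n))
    , λ q Pq → All.lookup (Extrema.xs≤max x (filter P? (allFin n))) (∈-filter⁺ P? (∈-allFin q) Pq)
    where module Extrema = Data.List.Extrema ≼-totalOrder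

  max-unique : ∀ {P m m'} → IsMax G _≺_ P m → IsMax G _≺_ P m' → m ≡ m'
  max-unique (Pm , ≼m) (Pm' , ≼m') = IsTotalOrder.antisym ≼-isTotalOrder (≼m' _ Pm) (≼m _ Pm')

  ≼-≺-trans : ∀ {a b c} → _≼_ G _≺_ a b → b ≺ c → a ≺ c
  ≼-≺-trans = ≤.≤-<-trans sym ≺.trans (λ { refl a≺c → a≺c })

  IsTop : Fin n → Fin n → Fin n → Set
  IsTop i j = IsMax G _≺_ (_∈ T i j)

  isTop? : ∀ i j q → Dec (IsTop i j q)
  isTop? i j q = q ∈? T i j ×-dec all? λ r → r ∈? T i j →-dec ≤.decidable′ ≺.compare r q

  module _ (≺-topological : IsTopological⊗Order G _≺_) where

    node≺top : ∀ {i j q} → IsTop i j q → i ≺ q × j ≺ q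
    node≺top {i} {j} {q} top@(q∈T , _) with max-exists (λ r → r ≟ᶠ i ⊎-dec r ≟ᶠ j) (inj₁ refl)
    ... | a , a-max@(_ , ≼a) =
      let a≺q = proj₂ ≺-topological i j (q , q∈T) a q a-max top
      in ≼-≺-trans (≼a i (inj₁ refl)) a≺q , ≼-≺-trans (≼a j (inj₂ refl)) a≺q

bounded : ∀ {n} (f : Fin n → ℕ) → ∃ λ H → ∀ p → f p ≤ H
bounded {zero}  f = 0 , λ ()
bounded {suc n} f with bounded (f ∘ Fin.suc)
... | H , f≤H = f Fin.zero ⊔ H , λ where
  Fin.zero    → m≤m⊔n _ H
  (Fin.suc p) → ≤-trans (f≤H p) (m≤n⊔m _ H)

idx : ∀ {n} → Fin n → ℕ → ℕ
idx {n} p k = k * n + toℕ p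

record Origin : Set where
  constructor origin
  field
    level : ℕ
    seed  : ℕ → ℕ
open Origin

Reached : Maybe Origin → Set
Reached m = ∃ λ o → m ≡ just o

reached? : ∀ m → Dec (Reached m)
reached? (just o) = yes (o , refl)
reached? nothing  = no λ ()

module Stages {n : ℕ} (G : ⊗Graph n) where
  open ⊗Graph G

  Fires : (Fin n → Maybe Origin) → Fin n → Set
  Fires I p = ∃₂ λ i j → Reached (I i) × Reached (I j) × p ∈ T i j

  fires? : ∀ I p → Dec (Fires I p)
  fires? I p = any? λ i → any? λ j → reached? (I i) ×-dec reached? (I j) ×-dec p ∈? T i j

  source? : ∀ p → Dec (IsSource G p)
  source? p = all? λ i → all? λ j → ¬? (p ∈? T i j)

  initial : ∀ p → Dec (IsSource G p) → Maybe Origin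
  initial p (yes _) = just (origin 0 (atom ∘ idx p))
  initial p (no _)  = nothing

  -- first components use seed 0 and second components seed suc (idx p k), so the seeds of
  -- different (p, k) differ
  fired : ℕ → ∀ {I} p → Dec (Fires I p) → Maybe Origin
  fired ℓ p (yes (_ , _ , (oᵢ , _) , (oⱼ , _) , _)) =
    just (origin (suc ℓ) λ k → pair (seed oᵢ 0) (seed oⱼ (suc (idx p k))))
  fired ℓ p (no _) = nothing

  stage : ℕ → Fin n → Maybe Origin
  stage zero    p = initial p (source? p)
  stage (suc ℓ) p = stage ℓ p <∣> fired ℓ p (fires? (stage ℓ) p)

  stage-step : ∀ {ℓ p o} → stage ℓ p ≡ just o → stage (suc ℓ) p ≡ just o
  stage-step {ℓ} {p} e = cong (_<∣> fired ℓ p (fires? (stage ℓ) p)) e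

  stage-mono : ∀ {ℓ ℓ' p o} → ℓ ≤′ ℓ' → stage ℓ p ≡ just o → stage ℓ' p ≡ just o
  stage-mono ≤′-refl        e = e
  stage-mono (≤′-step ℓ≤ℓ') e = stage-step (stage-mono ℓ≤ℓ' e)

  fires⇒reached : ∀ ℓ p → Fires (stage ℓ) p → Reached (stage (suc ℓ) p)
  fires⇒reached ℓ p f with stage ℓ p | fires? (stage ℓ) p
  ... | just o  | _                                        = o , refl
  ... | nothing | yes (_ , _ , (oᵢ , _) , (oⱼ , _) , _) = _ , refl
  ... | nothing | no ¬f                                    = ⊥-elim (¬f f)

  source⇒reached : ∀ {p} → IsSource G p → Reached (initial p (source? p))
  source⇒reached {p} src with source? p
  ... | yes _   = _ , refl
  ... | no ¬src = ⊥-elim (¬src src)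

  reach : ∀ {p} → Accessible G p → ∃ λ ℓ → Reached (stage ℓ p)
  reach (source src) = 0 , source⇒reached src
  reach (fire {p = p} dᵢ dⱼ p∈T) with reach dᵢ | reach dⱼ
  ... | ℓᵢ , oᵢ , eᵢ | ℓⱼ , oⱼ , eⱼ =
    suc (ℓᵢ ⊔ ℓⱼ) , fires⇒reached (ℓᵢ ⊔ ℓⱼ) p
      ( _ , _ , (oᵢ , stage-mono (≤⇒≤′ (m≤m⊔n ℓᵢ ℓⱼ)) eᵢ)
              , (oⱼ , stage-mono (≤⇒≤′ (m≤n⊔m ℓᵢ ℓⱼ)) eⱼ) , p∈T)

  Shape : ℕ → Fin n → Origin → Set
  Shape ℓ p o =
      (IsSource G p × ∀ k → seed o k ≡ atom (idx p k))
    ⊎ (∃₂ λ i j → ∃₂ λ oᵢ oⱼ → stage ℓ i ≡ just oᵢ × stage ℓ j ≡ just oⱼ ×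
         level oᵢ < level o × level oⱼ < level o × p ∈ T i j ×
         ∀ k → seed o k ≡ pair (seed oᵢ 0) (seed oⱼ (suc (idx p k))))

  stage-shape : ∀ ℓ p {o} → stage ℓ p ≡ just o → level o ≤ ℓ × Shape ℓ p o
  stage-shape zero p e with source? p | e
  ... | yes src | refl = z≤n , inj₁ (src , λ k → refl)
  stage-shape (suc ℓ) p e with stage ℓ p in e₀ | e
  ... | just o | refl with stage-shape ℓ p e₀
  ...   | o≤ℓ , inj₁ src-shape = m≤n⇒m≤1+n o≤ℓ , inj₁ src-shape
  ...   | o≤ℓ , inj₂ (i , j , oᵢ , oⱼ , eᵢ , eⱼ , rest) =
          m≤n⇒m≤1+n o≤ℓ , inj₂ (i , j , oᵢ , oⱼ , stage-step eᵢ , stage-step eⱼ , rest)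
  stage-shape (suc ℓ) p e | nothing | e' with fires? (stage ℓ) p | e'
  ... | yes (i , j , (oᵢ , eᵢ) , (oⱼ , eⱼ) , p∈T) | refl =
    ≤-refl , inj₂ (i , j , oᵢ , oⱼ , stage-step eᵢ , stage-step eⱼ ,
                   s≤s (proj₁ (stage-shape ℓ i eᵢ)) , s≤s (proj₁ (stage-shape ℓ j eⱼ)) ,
                   p∈T , λ k → refl)

  module Seeds (accessible : IsAccessible G) where
    private
      reach-bound : ∃ λ H → ∀ p → proj₁ (reach (accessible p)) ≤ H
      reach-bound = bounded λ p → proj₁ (reach (accessible p))

    H : ℕ
    H = proj₁ reach-bound

    reached-at-H : ∀ p → Reached (stage H p)
    reached-at-H p with reach (accessible p) | proj₂ reach-bound p
    ... | ℓ , o , e | ℓ≤H = o , stage-mono (≤⇒≤′ ℓ≤H) e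

    lev : Fin n → ℕ
    lev p = level (proj₁ (reached-at-H p))

    σ : Fin n → ℕ → ℕ
    σ p = seed (proj₁ (reached-at-H p))

    lev≤H : ∀ p → lev p ≤ H
    lev≤H p = proj₁ (stage-shape H p (proj₂ (reached-at-H p)))

    σ-shape : ∀ p → (IsSource G p × ∀ k → σ p k ≡ atom (idx p k))
                  ⊎ (∃₂ λ i j → lev i < lev p × lev j < lev p × p ∈ T i j ×
                       ∀ k → σ p k ≡ pair (σ i 0) (σ j (suc (idx p k))))
    σ-shape p with stage-shape H p (proj₂ (reached-at-H p))
    ... | _ , inj₁ src-shape = inj₁ src-shape
    ... | _ , inj₂ (i , j , oᵢ , oⱼ , eᵢ , eⱼ , rest)
      with just-injective (trans (sym (proj₂ (reached-at-H i))) eᵢ)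
         | just-injective (trans (sym (proj₂ (reached-at-H j))) eⱼ)
    ... | refl | refl = inj₂ (i , j , rest)

quot-rem-injective : ∀ {n a a'} k k' → a < n → a' < n → k * n + a ≡ k' * n + a' → k ≡ k' × a ≡ a'
quot-rem-injective zero zero _ _ eq = refl , eq
quot-rem-injective {n} {a} zero (suc k') a<n _ eq =
  ⊥-elim (<⇒≱ a<n (subst (n ≤_) (sym eq) (≤-trans (m≤m+n n (k' * n)) (m≤m+n _ _))))
quot-rem-injective {n} {a' = a'} (suc k) zero _ a'<n eq =
  ⊥-elim (<⇒≱ a'<n (subst (n ≤_) eq (≤-trans (m≤m+n n (k * n)) (m≤m+n _ _))))
quot-rem-injective {n} {a} {a'} (suc k) (suc k') a<n a'<n eq
  with quot-rem-injective k k' a<n a'<n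
         (+-cancelˡ-≡ n _ _ (trans (sym (+-assoc n (k * n) a)) (trans eq (+-assoc n (k' * n) a'))))
... | refl , a≡a' = refl , a≡a'

idx-injective : ∀ {n} {p p' : Fin n} {k k'} → idx p k ≡ idx p' k' → p ≡ p' × k ≡ k'
idx-injective {p = p} {p'} {k} {k'} eq with quot-rem-injective k k' (toℕ<n p) (toℕ<n p') eq
... | k≡k' , p≡p' = toℕ-injective p≡p' , k≡k'

module Construction {n : ℕ} (G : ⊗Graph n) {_≺_ : Rel (Fin n) 0ℓ}
                    (topological : IsTopological⊗Order G _≺_) (accessible : IsAccessible G) where
  open ⊗Graph G
  open Stages G
  open Seeds accessible
  open Maxima G (proj₁ topological)

  -- the seeds of p below C p use seeds of lower-level places up to n · C p, so the number of
  -- seeds must grow by a factor n + 1 per level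
  C : Fin n → ℕ
  C p = suc n ^ (H ∸ lev p)

  C-pos : ∀ p → 0 < C p
  C-pos p = m^n>0 (suc n) (H ∸ lev p)

  idx<C : ∀ {p j k} → lev j < lev p → k < C p → suc (idx p k) < C j
  idx<C {p} {j} {k} j<p k<C = begin
    suc (suc (k * n + toℕ p)) ≡⟨ cong suc (+-suc (k * n) (toℕ p)) ⟨
    suc (k * n + suc (toℕ p)) ≤⟨ s≤s (+-monoʳ-≤ (k * n) (toℕ<n p)) ⟩
    suc (k * n + n)           ≡⟨ cong suc (+-comm (k * n) n) ⟩
    suc (suc k * n)           ≤⟨ +-mono-≤ (C-pos p) (*-monoˡ-≤ n k<C) ⟩
    C p + C p * n             ≡⟨ cong (C p +_) (*-comm (C p) n) ⟩
    suc n ^ suc (H ∸ lev p)   ≤⟨ ^-monoʳ-≤ (suc n) (∸-monoʳ-< j<p (lev≤H p)) ⟩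
    C j                       ∎
    where open ≤-Reasoning

  σ-injective : ∀ {p p' k k'} → σ p k ≡ σ p' k' → p ≡ p' × k ≡ k'
  σ-injective {p} {k = k} = go (<-wellFounded (σ p k))
    where
    go : ∀ {p p' k k'} → Acc _<_ (σ p k) → σ p k ≡ σ p' k' → p ≡ p' × k ≡ k'
    go {p} {p'} {k} {k'} (acc smaller) eq with σ-shape p | σ-shape p'
    ... | inj₁ (_ , at) | inj₁ (_ , at') =
      idx-injective (atom-injective (trans (sym (at k)) (trans eq (at' k'))))
    ... | inj₁ (_ , at) | inj₂ (_ , _ , _ , _ , _ , pr') =
      ⊥-elim (atom≢pair _ _ _ (trans (sym (at k)) (trans eq (pr' k'))))
    ... | inj₂ (_ , _ , _ , _ , _ , pr) | inj₁ (_ , at') =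
      ⊥-elim (atom≢pair _ _ _ (trans (sym (at' k')) (trans (sym eq) (pr k))))
    ... | inj₂ (i , j , _ , _ , _ , pr) | inj₂ (i' , j' , _ , _ , _ , pr')
      with pair-injective (trans (sym (pr k)) (trans eq (pr' k')))
    ... | inj₁ (_ , σj≡σj') with go (smaller (subst (_ <_) (sym (pr k)) (pairʳ< _ _))) σj≡σj'
    ...   | refl , idx≡idx' = idx-injective (suc-injective idx≡idx')
    go (acc smaller) eq | inj₂ (i , j , _ , _ , _ , pr) | inj₂ (i' , j' , _ , _ , _ , pr')
      | inj₂ (σi≡σj' , _) with go (smaller (subst (_ <_) (sym (pr _)) (pairˡ< _ _))) σi≡σj'
    ...   | _ , ()

  Base : Fin n → List ℕ
  Base p = applyUpTo (σ p) (C p)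

  seeds : List ℕ
  seeds = concatMap Base (allFin n)

  σ∈seeds : ∀ {p k} → k < C p → σ p k ∈ₗ seeds
  σ∈seeds {p} k<C = ∈-concatMap⁺ Base (lose (∈-allFin p) (∈-applyUpTo⁺ (σ p) k<C))

  seeds-σ : ∀ {e} → e ∈ₗ seeds → ∃₂ λ p k → k < C p × e ≡ σ p k
  seeds-σ e∈ with find (∈-concatMap⁻ Base {xs = allFin n} e∈)
  ... | p , _ , e∈Base = p , ∈-applyUpTo⁻ (σ p) e∈Base

  fresh? : Decidable (λ e → ¬ e ∈ₗ seeds)
  fresh? e = ¬? (e ∈ₗ? seeds)

  -- pairs that are already seeds stay with the seed's place, keeping R disjoint
  newPairs : List ℕ → List ℕ → List ℕ
  newPairs A B = filter (fresh?) (cartesianProductWith pair A B)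

  ≺-wellFounded : WellFounded _≺_
  ≺-wellFounded = spo-wellFounded (IsStrictTotalOrder.isStrictPartialOrder (proj₁ topological))

  bulk : ∀ {q} → WfRec _≺_ (λ _ → List ℕ) q → ∀ {i j} → Dec (IsTop i j q) → List ℕ
  bulk IH (yes top) = let i≺q , j≺q = node≺top topological top in newPairs (IH i≺q) (IH j≺q)
  bulk IH (no _)    = []

  step : ∀ q → WfRec _≺_ (λ _ → List ℕ) q → List ℕ
  step q IH = Base q ++ concatMap (λ i → concatMap (λ j → bulk IH (isTop? i j q)) (allFin n)) (allFin n)

  R : Fin n → List ℕ
  R = All.wfRec ≺-wellFounded 0ℓ (λ _ → List ℕ) step

  R-unfold : ∀ {q} → R q ≡ step q (λ {i} _ → R i)
  R-unfold = FixPoint.unfold-wfRec ≺-wellFounded (λ _ → List ℕ) step step-ext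
    where
    step-ext : ∀ q {IH IH' : WfRec _≺_ (λ _ → List ℕ) q} → (∀ {i} i≺q → IH {i} i≺q ≡ IH' i≺q) →
               step q IH ≡ step q IH'
    step-ext q {IH} {IH'} IH≗IH' =
      cong (Base q ++_) (concatMap-cong (λ i → concatMap-cong (bulk-ext i) (allFin n)) (allFin n))
      where
      bulk-ext : ∀ i j → bulk IH (isTop? i j q) ≡ bulk IH' (isTop? i j q)
      bulk-ext i j with isTop? i j q
      ... | yes _ = cong₂ newPairs (IH≗IH' _) (IH≗IH' _)
      ... | no _  = refl

  NewPair : Fin n → ℕ → Set
  NewPair q e =
    ∃₂ λ i j → ∃₂ λ a b → IsTop i j q × a ∈ₗ R i × b ∈ₗ R j × e ≡ pair a b × ¬ e ∈ₗ seeds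

  ∈bulk⁻ : ∀ {e q i j} (top? : Dec (IsTop i j q)) → e ∈ₗ bulk (λ {i} _ → R i) top? → NewPair q e
  ∈bulk⁻ {e} {q} {i} {j} (yes top) e∈
    with ∈-filter⁻ (fresh?) {xs = cartesianProductWith pair (R i) (R j)} e∈
  ... | e∈R×R , e∉ with ∈-cartesianProductWith⁻ pair (R i) (R j) e∈R×R
  ...   | a , b , a∈ , b∈ , refl = i , j , a , b , top , a∈ , b∈ , refl , e∉

  ∈bulk⁺ : ∀ {a b q i j} (top? : Dec (IsTop i j q)) → IsTop i j q → a ∈ₗ R i → b ∈ₗ R j →
           ¬ pair a b ∈ₗ seeds → pair a b ∈ₗ bulk (λ {i} _ → R i) top?
  ∈bulk⁺ (yes _)   _   a∈ b∈ ∉ = ∈-filter⁺ (fresh?) (∈-cartesianProductWith⁺ pair a∈ b∈) ∉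
  ∈bulk⁺ (no ¬top) top _  _  _ = ⊥-elim (¬top top)

  ∈R⁻ : ∀ {e q} → e ∈ₗ R q → (∃ λ k → k < C q × e ≡ σ q k) ⊎ NewPair q e
  ∈R⁻ {e} {q} e∈ with ∈-++⁻ (Base q) (subst (e ∈ₗ_) R-unfold e∈)
  ... | inj₁ e∈Base = inj₁ (∈-applyUpTo⁻ (σ q) e∈Base)
  ... | inj₂ e∈bulk with find (∈-concatMap⁻ _ {xs = allFin n} e∈bulk)
  ...   | i , _ , e∈ᵢ with find (∈-concatMap⁻ _ {xs = allFin n} e∈ᵢ)
  ...     | j , _ , e∈ᵢⱼ = inj₂ (∈bulk⁻ (isTop? i j q) e∈ᵢⱼ)

  σ∈R : ∀ {q k} → k < C q → σ q k ∈ₗ R q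
  σ∈R {q} k<C = subst (_ ∈ₗ_) (sym R-unfold) (∈-++⁺ˡ (∈-applyUpTo⁺ (σ q) k<C))

  newPair∈R : ∀ {i j q a b} → IsTop i j q → a ∈ₗ R i → b ∈ₗ R j → ¬ pair a b ∈ₗ seeds →
              pair a b ∈ₗ R q
  newPair∈R {i} {j} {q} top a∈ b∈ ∉ =
    subst (_ ∈ₗ_) (sym R-unfold) (∈-++⁺ʳ (Base q) (∈-concatMap⁺ _ (lose (∈-allFin i)
      (∈-concatMap⁺ _ (lose (∈-allFin j) (∈bulk⁺ (isTop? i j q) top a∈ b∈ ∉))))))

  IsTop-sym : ∀ {i j q} → IsTop i j q → IsTop j i q
  IsTop-sym {i} {j} {q} = subst (λ S → IsMax G _≺_ (_∈ S) q) (T-sym i j)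

  R-disjoint : ∀ {e q q'} → e ∈ₗ R q → e ∈ₗ R q' → q ≡ q'
  R-disjoint {e} = go (<-wellFounded e)
    where
    go : ∀ {e q q'} → Acc _<_ e → e ∈ₗ R q → e ∈ₗ R q' → q ≡ q'
    go (acc smaller) e∈ e∈' with ∈R⁻ e∈ | ∈R⁻ e∈'
    ... | inj₁ (_ , _ , refl)   | inj₁ (_ , _ , eq) = proj₁ (σ-injective eq)
    ... | inj₁ (_ , k<C , refl) | inj₂ (_ , _ , _ , _ , _ , _ , _ , _ , e∉) =
      ⊥-elim (e∉ (σ∈seeds k<C))
    ... | inj₂ (_ , _ , _ , _ , _ , _ , _ , _ , e∉) | inj₁ (_ , k<C , refl) =
      ⊥-elim (e∉ (σ∈seeds k<C))
    ... | inj₂ (_ , _ , a , b , top , a∈ , b∈ , refl , _)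
        | inj₂ (_ , _ , _ , _ , top' , a∈' , b∈' , eq , _) with pair-injective eq
    ... | inj₁ (refl , refl)
      with go (smaller (pairˡ< a b)) a∈ a∈' | go (smaller (pairʳ< a b)) b∈ b∈'
    ...   | refl | refl = max-unique top top'
    go (acc smaller) e∈ e∈' | inj₂ (_ , _ , a , b , top , a∈ , b∈ , refl , _)
      | inj₂ (_ , _ , _ , _ , top' , a∈' , b∈' , eq , _) | inj₂ (refl , refl)
      with go (smaller (pairˡ< a b)) a∈ b∈' | go (smaller (pairʳ< a b)) b∈ a∈'
    ...   | refl | refl = max-unique top (IsTop-sym top')

  R-closed : ∀ {i j a b} → Nonempty (T i j) → a ∈ₗ R i → b ∈ₗ R j →
             ∃ λ q → q ∈ T i j × pair a b ∈ₗ R q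
  R-closed {i} {j} {a} {b} (x , x∈T) a∈ b∈ with pair a b ∈ₗ? seeds
  ... | no ∉ with max-exists (_∈? T i j) x∈T
  ...   | q , top = q , proj₁ top , newPair∈R top a∈ b∈ ∉
  R-closed {i} {j} {a} {b} _ a∈ b∈ | yes ∈seeds with seeds-σ ∈seeds
  ... | p , k , k<C , ab≡σ with σ-shape p
  ...   | inj₁ (_ , at) = ⊥-elim (atom≢pair _ a b (trans (sym (at k)) (sym ab≡σ)))
  ...   | inj₂ (i' , j' , _ , j'<p , p∈T , pr) with pair-injective (trans ab≡σ (pr k))
  ...     | inj₁ (refl , refl)
          with R-disjoint a∈ (σ∈R (C-pos i')) | R-disjoint b∈ (σ∈R (idx<C j'<p k<C))
  ...       | refl | refl = p , p∈T , subst (_∈ₗ R p) (sym ab≡σ) (σ∈R k<C)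
  R-closed {i} {j} _ a∈ b∈ | yes _ | p , k , k<C , ab≡σ | inj₂ (i' , j' , _ , j'<p , p∈T , pr)
    | inj₂ (refl , refl) with R-disjoint a∈ (σ∈R (idx<C j'<p k<C)) | R-disjoint b∈ (σ∈R (C-pos i'))
  ...       | refl | refl = p , subst (p ∈_) (T-sym j i) p∈T , subst (_∈ₗ R p) (sym ab≡σ) (σ∈R k<C)

  R-pairs : ∀ {e q} → e ∈ₗ R q → (∃₂ λ i j → q ∈ T i j) →
            ∃₂ λ i j → ∃₂ λ a b → q ∈ T i j × a ∈ₗ R i × b ∈ₗ R j × e ≡ pair a b
  R-pairs {q = q} e∈ (i₀ , j₀ , q∈T₀) with ∈R⁻ e∈
  ... | inj₂ (i , j , a , b , top , a∈ , b∈ , eq , _) = i , j , a , b , proj₁ top , a∈ , b∈ , eq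
  ... | inj₁ (k , k<C , refl) with σ-shape q
  ...   | inj₁ (src , _) = ⊥-elim (src i₀ j₀ q∈T₀)
  ...   | inj₂ (i , j , _ , j<q , q∈T , pr) =
          i , j , _ , _ , q∈T , σ∈R (C-pos i) , σ∈R (idx<C j<q k<C) , pr k

  realization : Realization G
  realization = record
    { R           = R
    ; R-disjoint  = R-disjoint
    ; R-inhabited = λ q → σ q 0 , σ∈R (C-pos q)
    ; R-closed    = R-closed
    ; R-pairs     = R-pairs
    }

lemma16 : (n : ℕ) (G : ⊗Graph n) (_≺_ : Rel (Fin n) 0ℓ) →
          IsTopological⊗Order G _≺_ → IsAccessible G →
          (Φ : Conjunction) → Fulfills G Φ → HFSatisfiable Φ
lemma16 n G _≺_ topological accessible Φ (F , fulfilled) =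
  ⟪_⟫ ∘ F , All.map (fulfils⇒satisfies F) fulfilled
  where open Model (Construction.realization G topological accessible)
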